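{- Let $A$ be a justified AJM game, $\sigma$ a strategy on $A$, and $\phi$ a skeleton of $\sigma$. Then $\phi^\bullet=\sigma$, where $\phi^\bullet=\{t\mid\exists s\in\phi.\ s\approx_A t\}$.
   Context: A justified AJM game $A=(M_A,\lambda_A,\mathsf{j}_A,P_A,\approx_A)$: set of moves $M_A$; labelling $\lambda_A:M_A\to\{P,O\}\times\{Q,A\}$; a partial justification function (well-founded; P-moves justified by O-moves and vice versa; answers justified by questions); a non-empty prefix-closed set $P_A$ of finite move sequences (plays) which start with an O-move, alternate O/P, contain each move at most once, are prefixes of well-bracketed strings, and contain the justifier of each move earlier; an equivalence $\approx_A$ on $P_A$ such that (e1) $s\approx_A t$ implies equal label sequences, (e2) equal-length prefixes of equivalent plays are equivalent, (e3) $s\approx_A t$, $sa\in P_A$ imply $sa\approx_A tb$ for some $b$. A strategy on $A$: a non-empty set $\sigma$ of even-length plays with Causal Consistency ($sab\in\sigma\Rightarrow s\in\sigma$), Representation Independence ($s\in\sigma$, $s\approx_A t\Rightarrow t\in\sigma$), Determinacy ($sab,ta'b'\in\sigma$, $sa\approx_A ta'\Rightarrow sab\approx_A ta'b'$). A skeleton of $\sigma$ is a non-empty causally consistent subset $\phi\subseteq\sigma$ satisfying Uniformization: for all $sab\in\sigma$ with $s\in\phi$ there is a unique $b'$ with $sab'\in\phi$. -}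

module Defs where

open import Data.Nat using (ℕ; zero; suc)
open import Data.List using (List; []; _∷_; _++_; _∷ʳ_; map; length; take)
open import Data.List.Membership.Propositional using (_∈_)
open import Data.List.Relation.Unary.Unique.Propositional using (Unique)
open import Data.Maybe using (Maybe; just; nothing)
open import Data.Product using (Σ; ∃; ∃!; _×_; _,_; proj₁; proj₂)
open import Relation.Binary.PropositionalEquality using (_≡_; _≢_)
open import Induction.WellFounded using (WellFounded)

data Pol : Set where
  O P : Pol

data Kind : Set where
  Q A : Kind

Label : Set
Label = Pol × Kind

pol : Label → Pol
pol = proj₁

kind : Label → Kind
kind = proj₂

opp : Pol → Pol
opp O = P
opp P = O

data AltFrom : Pol → List Pol → Set where
  alt-[] : ∀ {p} → AltFrom p []
  alt-∷  : ∀ {p ps} → AltFrom (opp p) ps → AltFrom p (p ∷ ps)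

data WellBracketed : List Kind → Set where
  wb-ε   : WellBracketed []
  wb-nest : ∀ {w} → WellBracketed w → WellBracketed (Q ∷ w ∷ʳ A)
  wb-cat : ∀ {w v} → WellBracketed w → WellBracketed v → WellBracketed (w ++ v)

PrefixWB : List Kind → Set
PrefixWB w = ∃ λ u → WellBracketed (w ++ u)

record Game : Set₁ where
  field
    Move  : Set
    λA    : Move → Label
    jA    : Move → Maybe Move
    Play  : List Move → Set
    _≈_   : List Move → List Move → Set

  Justifies : Move → Move → Set
  Justifies m n = jA n ≡ just m

  field
    j-wf       : WellFounded Justifies
    j-pol      : ∀ {m n} → Justifies m n → pol (λA m) ≢ pol (λA n)
    j-ans      : ∀ {m n} → Justifies m n → kind (λA n) ≡ A → kind (λA m) ≡ Q
    play-nonempty  : ∃ Play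
    play-prefix    : ∀ s t → Play (s ++ t) → Play s
    play-alt       : ∀ {s} → Play s → AltFrom O (map (λ m → pol (λA m)) s)
    play-unique    : ∀ {s} → Play s → Unique s
    play-wb        : ∀ {s} → Play s → PrefixWB (map (λ m → kind (λA m)) s)
    play-justified : ∀ s₁ m s₂ n → Play (s₁ ++ m ∷ s₂) → jA m ≡ just n → n ∈ s₁
    ≈-plays : ∀ {s t} → s ≈ t → Play s × Play t
    ≈-refl  : ∀ {s} → Play s → s ≈ s
    ≈-sym   : ∀ {s t} → s ≈ t → t ≈ s
    ≈-trans : ∀ {s t u} → s ≈ t → t ≈ u → s ≈ u
    e1 : ∀ {s t} → s ≈ t → map λA s ≡ map λA t
    e2 : ∀ {s t} → s ≈ t → ∀ n → take n s ≈ take n t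
    e3 : ∀ {s t a} → s ≈ t → Play (s ∷ʳ a) → ∃ λ b → (s ∷ʳ a) ≈ (t ∷ʳ b)

module _ (G : Game) where
  open Game G

  data Even {X : Set} : List X → Set where
    even-[] : Even []
    even-∷∷ : ∀ {x y xs} → Even xs → Even (x ∷ y ∷ xs)

  record IsStrategy (σ : List Move → Set) : Set where
    field
      nonempty     : ∃ σ
      plays        : ∀ {s} → σ s → Play s
      even         : ∀ {s} → σ s → Even s
      causal       : ∀ {s a b} → σ (s ∷ʳ a ∷ʳ b) → σ s
      repIndep     : ∀ {s t} → σ s → s ≈ t → σ t
      determinacy  : ∀ {s a b t a′ b′} → σ (s ∷ʳ a ∷ʳ b) → σ (t ∷ʳ a′ ∷ʳ b′) →
                     (s ∷ʳ a) ≈ (t ∷ʳ a′) → (s ∷ʳ a ∷ʳ b) ≈ (t ∷ʳ a′ ∷ʳ b′)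

  record IsSkeleton (σ φ : List Move → Set) : Set where
    field
      subset        : ∀ {s} → φ s → σ s
      nonempty      : ∃ φ
      causal        : ∀ {s a b} → φ (s ∷ʳ a ∷ʳ b) → φ s
      uniformize    : ∀ {s a b} → σ (s ∷ʳ a ∷ʳ b) → φ s →
                      ∃! _≡_ (λ b′ → φ (s ∷ʳ a ∷ʳ b′))

  _• : (List Move → Set) → List Move → Set
  (φ •) t = ∃ λ s → φ s × (s ≈ t)

module Submission where

-- The inclusion φ• ⊆ σ is immediate: φ ⊆ σ and σ is closed under ≈
-- (representation independence).  For σ ⊆ φ• we induct on an even-length
-- play t ∈ σ, viewed as built by appending O/P pairs at the END
-- (the `EvenSnoc` view, obtained from the cons-based `Even` of the
-- definitions).  The empty play is equivalent to the root [] of φ,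
-- which every skeleton contains by causal consistency.  For t a b ∈ σ
-- with a representative s ≈ t in φ, axiom (e3) transports the O-move a
-- to some a′ with t a ≈ s a′ and then b to some b″ with t a b ≈ s a′ b″;
-- so s a′ b″ ∈ σ, uniformization picks b′ with s a′ b′ ∈ φ, and
-- determinacy of σ gives s a′ b′ ≈ t a b.

open import Defs
open import Data.List using (List; []; _∷_; _∷ʳ_)
open import Data.Product using (_×_; _,_; ∃)

module SkeletonReconstruction (G : Game) where
  open Game G

  -- Even-length lists viewed as built from [] by appending pairs at the
  -- end; this is the induction principle matching causal consistency.
  data EvenSnoc {X : Set} : List X → Set where
    snoc-[]  : EvenSnoc []
    snoc-∷ʳ∷ʳ : ∀ {xs x y} → EvenSnoc xs → EvenSnoc (xs ∷ʳ x ∷ʳ y)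

  evenSnoc-cons : ∀ {X : Set} {x y : X} {xs} → EvenSnoc xs → EvenSnoc (x ∷ y ∷ xs)
  evenSnoc-cons snoc-[]       = snoc-∷ʳ∷ʳ snoc-[]
  evenSnoc-cons (snoc-∷ʳ∷ʳ e) = snoc-∷ʳ∷ʳ (evenSnoc-cons e)

  even⇒evenSnoc : ∀ {X : Set} {xs : List X} → Even G xs → EvenSnoc xs
  even⇒evenSnoc even-[]      = snoc-[]
  even⇒evenSnoc (even-∷∷ e)  = evenSnoc-cons (even⇒evenSnoc e)

  root-of-closed : (ψ : List Move → Set) →
    (∀ {s a b} → ψ (s ∷ʳ a ∷ʳ b) → ψ s) →
    ∀ {s} → EvenSnoc s → ψ s → ψ []
  root-of-closed ψ close snoc-[]        ψs = ψs
  root-of-closed ψ close (snoc-∷ʳ∷ʳ e)  ψs = root-of-closed ψ close e (close ψs)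

  module _ {σ φ : List Move → Set} (S : IsStrategy G σ) (K : IsSkeleton G σ φ) where
    private
      module S = IsStrategy S
      module K = IsSkeleton K

    skeleton-root : φ []
    skeleton-root with K.nonempty
    ... | s , φs = root-of-closed φ K.causal (even⇒evenSnoc (S.even (K.subset φs))) φs

    •⊆strategy : ∀ {t} → _• G φ t → σ t
    •⊆strategy (s , φs , s≈t) = S.repIndep (K.subset φs) s≈t

    extend-representative : ∀ {t a b s} → σ (t ∷ʳ a ∷ʳ b) → φ s → s ≈ t →
      ∃ λ s′ → φ s′ × (s′ ≈ (t ∷ʳ a ∷ʳ b))
    extend-representative {t} {a} {b} {s} σtab φs s≈t
      with e3 (≈-sym s≈t) (play-prefix (t ∷ʳ a) (b ∷ []) (S.plays σtab))
    ... | a′ , ta≈sa′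
      with e3 ta≈sa′ (S.plays σtab)
    ... | b″ , tab≈sa′b″
      with K.uniformize (S.repIndep σtab tab≈sa′b″) φs
    ... | b′ , φsa′b′ , _ =
      s ∷ʳ a′ ∷ʳ b′ , φsa′b′ , S.determinacy (K.subset φsa′b′) σtab (≈-sym ta≈sa′)

    strategy⊆• : ∀ {t} → EvenSnoc t → σ t → _• G φ t
    strategy⊆• snoc-[] σ[] =
      [] , skeleton-root , ≈-refl (S.plays (K.subset skeleton-root))
    strategy⊆• (snoc-∷ʳ∷ʳ e) σtab with strategy⊆• e (S.causal σtab)
    ... | s , φs , s≈t = extend-representative σtab φs s≈t

mainTheorem12 : (G : Game) (σ φ : List (Game.Move G) → Set) →
    IsStrategy G σ → IsSkeleton G σ φ →
    (∀ t → _• G φ t → σ t) × (∀ t → σ t → _• G φ t)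
mainTheorem12 G σ φ S K =
    (λ t → •⊆strategy S K)
  , (λ t σt → strategy⊆• S K (even⇒evenSnoc (IsStrategy.even S σt)) σt)
  where open SkeletonReconstruction G
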